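{- Let $N = \{a,b,c,d,e,f,g,h,i,j\}$ be a set of ten distinct elements and let $G = \{\{a,b\}, \{a,d,c\}, \{a,e,f\}, \{a,i,h\}, \{b,e,c\}, \{b,g,f\}, \{b,j,h\}\}$. In the game in which Black and White alternately claim previously unclaimed elements of $N$, Black moving first, until all of $N$ is claimed, White has a strategy guaranteeing that every set in $G$ contains at least one element claimed by White.
   Context: This is the "TriTriangleX Configuration". The elements of $N$ are called markers, and the sets in $G$ are the traces on the markers of groups (possible winning lines) of a $k$-in-a-Row game. -}

module Defs where

open import Data.Fin using (Fin; _≟_; #_)
open import Data.List using (List; _∷_; [])
open import Data.List.Relation.Unary.All using (All)
open import Data.List.Relation.Unary.Any using (Any)
open import Relation.Binary.PropositionalEquality using (_≡_; _≢_)
open import Relation.Nullary using (¬_; yes; no)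

Marker : Set
Marker = Fin 10

a b c d e f g h i j : Marker
a = # 0
b = # 1
c = # 2
d = # 3
e = # 4
f = # 5
g = # 6
h = # 7
i = # 8
j = # 9

G : List (List Marker)
G = (a ∷ b ∷ [])
  ∷ (a ∷ d ∷ c ∷ [])
  ∷ (a ∷ e ∷ f ∷ [])
  ∷ (a ∷ i ∷ h ∷ [])
  ∷ (b ∷ e ∷ c ∷ [])
  ∷ (b ∷ g ∷ f ∷ [])
  ∷ (b ∷ j ∷ h ∷ [])
  ∷ []

data Cell : Set where
  free black white : Cell

Board : Set
Board = Marker → Cell

emptyBoard : Board
emptyBoard _ = free

_[_↦_] : Board → Marker → Cell → Board
(β [ x ↦ col ]) y with y ≟ x
... | yes _ = col
... | no  _ = β y

AllClaimed : Board → Set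
AllClaimed β = ∀ x → β x ≢ free

WhiteGoal : Board → Set
WhiteGoal β = All (λ grp → Any (λ x → β x ≡ white) grp) G

-- An inhabitant is exactly a White strategy tree: at each White turn it
-- names a free marker to claim, and it covers every possible Black reply.
mutual
  data WhiteWinsBlackToMove (β : Board) : Set where
    finished : AllClaimed β → WhiteGoal β → WhiteWinsBlackToMove β
    blackMoves : ¬ AllClaimed β →
                 (∀ x → β x ≡ free → WhiteWinsWhiteToMove (β [ x ↦ black ])) →
                 WhiteWinsBlackToMove β

  data WhiteWinsWhiteToMove (β : Board) : Set where
    finished : AllClaimed β → WhiteGoal β → WhiteWinsWhiteToMove β
    whiteMoves : (x : Marker) → β x ≡ free →
                 WhiteWinsBlackToMove (β [ x ↦ white ]) →
                 WhiteWinsWhiteToMove β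

-- White first takes a hub: b if Black opened with a, and a otherwise. A group through a hub other
-- than {a,b} consists of the hub and one of three disjoint pairs, so once Black holds one hub and
-- White the other, White wins by answering each Black marker of a pair with its partner. If Black
-- opened off the hubs and then takes b, White runs this pairing strategy for b, answering Black's
-- first marker as though it had just been played; otherwise White takes b and already has a marker
-- in every group.
module Submission where

open import Defs
open import Data.Empty using (⊥-elim)
open import Data.Fin using (Fin; zero; suc; _≟_)
open import Data.Fin.Properties using (any?; all?)
import Data.Fin.Properties as Fin
open import Data.List using (List; []; _∷_)
open import Data.List.Membership.Propositional using (_∈_; lose)
open import Data.List.Relation.Unary.All as All using (All; []; _∷_)
open import Data.List.Relation.Unary.Any as Any using (Any; here; there)
open import Data.Maybe using (Maybe; just; nothing)
open import Data.Maybe.Properties using (just-injective)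
import Data.Maybe.Properties as Maybe
open import Data.Nat using (ℕ; zero; suc; _+_)
open import Data.Nat.Properties using (+-suc; 0≢1+n; suc-injective)
open import Data.Product using (∃-syntax; _×_; _,_)
open import Data.Sum using (_⊎_; inj₁; inj₂)
import Data.Sum as Sum
open import Function using (_∘_; case_of_)
open import Relation.Binary.PropositionalEquality
  using (_≡_; _≢_; refl; sym; trans; cong; cong₂; subst; module ≡-Reasoning)
open import Relation.Nullary using (Dec; yes; no; ¬?)
open import Relation.Nullary.Decidable using (True; toWitness; _×-dec_; _→-dec_)

free? : (c : Cell) → Dec (c ≡ free)
free? free = yes refl
free? black = no λ ()
free? white = no λ ()

update-same : ∀ (β : Board) x col → (β [ x ↦ col ]) x ≡ col
update-same β x col with x ≟ x
... | yes _ = refl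
... | no x≢x = ⊥-elim (x≢x refl)

update-other : ∀ (β : Board) x col {y} → y ≢ x → (β [ x ↦ col ]) y ≡ β y
update-other β x col {y} y≢x with y ≟ x
... | yes y≡x = ⊥-elim (y≢x y≡x)
... | no _ = refl

claim-keeps-white : ∀ (β : Board) x col {y} → β x ≡ free → β y ≡ white → (β [ x ↦ col ]) y ≡ white
claim-keeps-white β x col {y} fx wy with y ≟ x
... | yes refl with () ← trans (sym wy) fx
... | no _ = wy

white-claim-keeps-black : ∀ (β : Board) x {y} → (β [ x ↦ white ]) y ≡ black → β y ≡ black
white-claim-keeps-black β x {y} by with y ≟ x
... | yes _ with () ← by
... | no _ = by

weight : Cell → ℕ
weight free = 1
weight black = 0
weight white = 0

freeCount : ∀ {n} → (Fin n → Cell) → ℕ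
freeCount {zero} β = 0
freeCount {suc n} β = weight (β zero) + freeCount (β ∘ suc)

freeCount-cong : ∀ {n} {β γ : Fin n → Cell} → (∀ y → β y ≡ γ y) → freeCount β ≡ freeCount γ
freeCount-cong {zero} _ = refl
freeCount-cong {suc n} β≗γ = cong₂ _+_ (cong weight (β≗γ zero)) (freeCount-cong (β≗γ ∘ suc))

freeCount-drop : ∀ {n} {β γ : Fin n → Cell} x → β x ≡ free → γ x ≢ free →
                 (∀ y → y ≢ x → γ y ≡ β y) → freeCount β ≡ suc (freeCount γ)
freeCount-drop {γ = γ} zero fx γx γ≗β rewrite fx with γ zero
... | free = ⊥-elim (γx refl)
... | black = cong suc (freeCount-cong λ y → sym (γ≗β (suc y) λ ()))
... | white = cong suc (freeCount-cong λ y → sym (γ≗β (suc y) λ ()))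
freeCount-drop {β = β} {γ} (suc x) fx γx γ≗β = begin
  weight (β zero) + freeCount (β ∘ suc)
    ≡⟨ cong₂ _+_ (cong weight (sym (γ≗β zero λ ())))
                 (freeCount-drop x fx γx λ y y≢x → γ≗β (suc y) (y≢x ∘ Fin.suc-injective)) ⟩
  weight (γ zero) + suc (freeCount (γ ∘ suc))
    ≡⟨ +-suc (weight (γ zero)) _ ⟩
  suc (freeCount γ) ∎
  where open ≡-Reasoning

freeCount-claim : ∀ (β : Board) x col → β x ≡ free → col ≢ free →
                  freeCount β ≡ suc (freeCount (β [ x ↦ col ]))
freeCount-claim β x col fx col≢free =
  freeCount-drop x fx (λ eq → col≢free (trans (sym (update-same β x col)) eq)) λ y → update-other β x col

freeCount≡0⇒allClaimed : ∀ (β : Board) → freeCount β ≡ 0 → AllClaimed β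
freeCount≡0⇒allClaimed β count x fx = 0≢1+n (trans (sym count) (freeCount-claim β x black fx λ ()))

record Pairing : Set where
  field
    partner : Marker → Maybe Marker
    symmetric : ∀ {x y} → partner x ≡ just y → partner y ≡ just x
    irreflexive : ∀ {x} → partner x ≢ just x

open Pairing

Paired : Pairing → Marker → Marker → Set
Paired π x y = partner π x ≡ just y

pairs : List (Marker × Marker) → Marker → Maybe Marker
pairs [] x = nothing
pairs ((p , q) ∷ ps) x with x ≟ p | x ≟ q
... | yes _ | _ = just q
... | no _ | yes _ = just p
... | no _ | no _ = pairs ps x

IsPairing : (Marker → Maybe Marker) → Set
IsPairing σ = (∀ x y → σ x ≡ just y → σ y ≡ just x) × (∀ x → σ x ≢ just x)

isPairing? : ∀ σ → Dec (IsPairing σ)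
isPairing? σ =
  all? (λ x → all? λ y → σ x ≟ᵐ just y →-dec σ y ≟ᵐ just x) ×-dec all? (λ x → ¬? (σ x ≟ᵐ just x))
  where _≟ᵐ_ = Maybe.≡-dec _≟_

pairing : (ps : List (Marker × Marker)) → True (isPairing? (pairs ps)) → Pairing
pairing ps valid with toWitness valid
... | sym-pairs , irrefl-pairs = record
  { partner = pairs ps
  ; symmetric = sym-pairs _ _
  ; irreflexive = irrefl-pairs _
  }

module _ (π : Pairing) where

  Guarded : Board → Set
  Guarded β = ∀ {p q} → Paired π p q → β p ≡ black → β q ≡ white

  GuardedExcept : Marker → Board → Set
  GuardedExcept x β = ∀ {p q} → p ≢ x → Paired π p q → β p ≡ black → β q ≡ white

  ContainsPair : List Marker → Set
  ContainsPair grp = ∃[ x ] ∃[ y ] (Paired π x y × x ∈ grp × y ∈ grp)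

  Covered : Board → Set
  Covered β = All (λ grp → Any (λ x → β x ≡ white) grp ⊎ ContainsPair grp) G

  first-move-guarded : ∀ x → GuardedExcept x (emptyBoard [ x ↦ black ])
  first-move-guarded x p≢x pq bp with () ← trans (sym (update-other emptyBoard x black p≢x)) bp

  guarded-claim-white : ∀ β z → β z ≡ free → Guarded β → Guarded (β [ z ↦ white ])
  guarded-claim-white β z fz guarded pq bp =
    claim-keeps-white β z white fz (guarded pq (white-claim-keeps-black β z bp))

  guardedExcept-claim-white : ∀ β x z → β z ≡ free → GuardedExcept x β →
                              GuardedExcept x (β [ z ↦ white ])
  guardedExcept-claim-white β x z fz guarded p≢x pq bp =
    claim-keeps-white β z white fz (guarded p≢x pq (white-claim-keeps-black β z bp))

  guarded-claim-black : ∀ β x → β x ≡ free → Guarded β → GuardedExcept x (β [ x ↦ black ])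
  guarded-claim-black β x fx guarded p≢x pq bp =
    claim-keeps-white β x black fx (guarded pq (trans (sym (update-other β x black p≢x)) bp))

  guardedExcept-claim-unpaired : ∀ β x y → β y ≡ free → partner π y ≡ nothing →
                                 GuardedExcept x β → GuardedExcept x (β [ y ↦ black ])
  guardedExcept-claim-unpaired β x y fy unpaired guarded {p} p≢x pq bp with p ≟ y
  ... | yes refl with () ← trans (sym unpaired) pq
  ... | no _ = claim-keeps-white β y black fy (guarded p≢x pq bp)

  guardedExcept-resolve : ∀ β x → (∀ {q} → Paired π x q → β q ≡ white) →
                          GuardedExcept x β → Guarded β
  guardedExcept-resolve β x atX guarded {p} pq bp with p ≟ x
  ... | yes refl = atX pq
  ... | no p≢x = guarded p≢x pq bp

  guardedExcept-unpaired⇒guarded : ∀ β x → partner π x ≡ nothing → GuardedExcept x β → Guarded β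
  guardedExcept-unpaired⇒guarded β x unpaired =
    guardedExcept-resolve β x λ pq → case trans (sym unpaired) pq of λ ()

  guardedExcept-whitePartner⇒guarded : ∀ β x y → Paired π x y → β y ≡ white →
                                       GuardedExcept x β → Guarded β
  guardedExcept-whitePartner⇒guarded β x y pxy wy =
    guardedExcept-resolve β x λ pxq → subst (λ q → β q ≡ white) (just-injective (trans (sym pxy) pxq)) wy

  covered-claim : ∀ β x col → β x ≡ free → Covered β → Covered (β [ x ↦ col ])
  covered-claim β x col fx = All.map (Sum.map₁ (Any.map (claim-keeps-white β x col fx)))

  white-in-group : ∀ {β grp} → AllClaimed β → Guarded β →
                   Any (λ x → β x ≡ white) grp ⊎ ContainsPair grp → Any (λ x → β x ≡ white) grp
  white-in-group done guarded (inj₁ white∈grp) = white∈grp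
  white-in-group {β} done guarded (inj₂ (x , y , pxy , x∈ , y∈)) with β x in bx
  ... | free = ⊥-elim (done x bx)
  ... | black = lose y∈ (guarded pxy bx)
  ... | white = lose x∈ bx

  whiteGoal : ∀ {β} → AllClaimed β → Guarded β → Covered β → WhiteGoal β
  whiteGoal done guarded = All.map (white-in-group done guarded)

  mutual
    blackToMove : ∀ n β → freeCount β ≡ n → Guarded β → Covered β → WhiteWinsBlackToMove β
    blackToMove zero β count guarded cov = finished done (whiteGoal done guarded cov)
      where done = freeCount≡0⇒allClaimed β count
    blackToMove (suc n) β count guarded cov with any? (λ z → free? (β z))
    ... | no none = finished (λ z fz → none (z , fz)) (whiteGoal (λ z fz → none (z , fz)) guarded cov)
    ... | yes (z , fz) = blackMoves (λ done → done z fz) λ x fx →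
      answer n (β [ x ↦ black ]) x
        (suc-injective (trans (sym (freeCount-claim β x black fx λ ())) count))
        (update-same β x black) (guarded-claim-black β x fx guarded) (covered-claim β x black fx cov)

    answer : ∀ n β x → freeCount β ≡ n → β x ≡ black → GuardedExcept x β → Covered β →
             WhiteWinsWhiteToMove β
    answer n β x count bx guarded cov with partner π x in px
    ... | nothing = whiteToMove n β count (guardedExcept-unpaired⇒guarded β x px guarded) cov
    ... | just y with β y in by
    ... | free = whiteClaims n β y count by
      (guardedExcept-whitePartner⇒guarded (β [ y ↦ white ]) x y px (update-same β y white)
        (guardedExcept-claim-white β x y by guarded)) cov
    ... | white = whiteToMove n β count (guardedExcept-whitePartner⇒guarded β x y px by guarded) cov
    ... | black with y ≟ x
    ...   | yes refl = ⊥-elim (irreflexive π px)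
    ...   | no y≢x with () ← trans (sym bx) (guarded y≢x (symmetric π px) by)

    whiteToMove : ∀ n β → freeCount β ≡ n → Guarded β → Covered β → WhiteWinsWhiteToMove β
    whiteToMove n β count guarded cov with any? (λ z → free? (β z))
    ... | no none = finished (λ z fz → none (z , fz)) (whiteGoal (λ z fz → none (z , fz)) guarded cov)
    ... | yes (z , fz) = whiteClaims n β z count fz (guarded-claim-white β z fz guarded) cov

    whiteClaims : ∀ n β z → freeCount β ≡ n → β z ≡ free → Guarded (β [ z ↦ white ]) → Covered β →
                  WhiteWinsWhiteToMove β
    whiteClaims zero β z count fz guarded cov = ⊥-elim (freeCount≡0⇒allClaimed β count z fz)
    whiteClaims (suc n) β z count fz guarded cov =
      whiteMoves z fz (blackToMove n (β [ z ↦ white ])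
        (suc-injective (trans (sym (freeCount-claim β z white fz λ ())) count))
        guarded (covered-claim β z white fz cov))

  pairing-wins : ∀ {β} → Guarded β → Covered β → WhiteWinsBlackToMove β
  pairing-wins {β} = blackToMove (freeCount β) β refl

  pairing-answers : ∀ {β} x → β x ≡ black → GuardedExcept x β → Covered β → WhiteWinsWhiteToMove β
  pairing-answers {β} x = answer (freeCount β) β x refl

pairing-a pairing-b no-pairs : Pairing
pairing-a = pairing ((d , c) ∷ (e , f) ∷ (i , h) ∷ []) _
pairing-b = pairing ((e , c) ∷ (g , f) ∷ (j , h) ∷ []) _
no-pairs = pairing [] _

covered-a : ∀ {β} → β b ≡ white → Covered pairing-a β
covered-a wb =
    inj₁ (there (here wb))
  ∷ inj₂ (d , c , refl , there (here refl) , there (there (here refl)))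
  ∷ inj₂ (e , f , refl , there (here refl) , there (there (here refl)))
  ∷ inj₂ (i , h , refl , there (here refl) , there (there (here refl)))
  ∷ inj₁ (here wb)
  ∷ inj₁ (here wb)
  ∷ inj₁ (here wb)
  ∷ []

covered-b : ∀ {β} → β a ≡ white → Covered pairing-b β
covered-b wa =
    inj₁ (here wa)
  ∷ inj₁ (here wa)
  ∷ inj₁ (here wa)
  ∷ inj₁ (here wa)
  ∷ inj₂ (e , c , refl , there (here refl) , there (there (here refl)))
  ∷ inj₂ (g , f , refl , there (here refl) , there (there (here refl)))
  ∷ inj₂ (j , h , refl , there (here refl) , there (there (here refl)))
  ∷ []

covered-hubs : ∀ {β} → β a ≡ white → β b ≡ white → Covered no-pairs β
covered-hubs wa wb =
    inj₁ (here wa)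
  ∷ inj₁ (here wa)
  ∷ inj₁ (here wa)
  ∷ inj₁ (here wa)
  ∷ inj₁ (here wb)
  ∷ inj₁ (here wb)
  ∷ inj₁ (here wb)
  ∷ []

other-hub-then-pairing : ∀ π u v → v ≢ u → partner π u ≡ nothing →
                         Covered π ((emptyBoard [ u ↦ black ]) [ v ↦ white ]) →
                         WhiteWinsWhiteToMove (emptyBoard [ u ↦ black ])
other-hub-then-pairing π u v v≢u unpaired cov =
  whiteMoves v fv (pairing-wins π (guarded-claim-white π β v fv guarded) cov)
  where
  β = emptyBoard [ u ↦ black ]
  fv = update-other emptyBoard u black {v} v≢u
  guarded : Guarded π β
  guarded = guardedExcept-unpaired⇒guarded π β u unpaired (first-move-guarded π u)

first-move-off-hubs : ∀ x → x ≢ a → x ≢ b → WhiteWinsWhiteToMove (emptyBoard [ x ↦ black ])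
first-move-off-hubs x x≢a x≢b = whiteMoves a fa (blackMoves (λ done → done b fb) second-reply)
  where
  β₀ = emptyBoard [ x ↦ black ]
  β₁ = β₀ [ a ↦ white ]
  fa : β₀ a ≡ free
  fa = update-other emptyBoard x black {a} (x≢a ∘ sym)
  wa : β₁ a ≡ white
  wa = update-same β₀ a white
  fb : β₁ b ≡ free
  fb = trans (update-other β₀ a white {b} λ ()) (update-other emptyBoard x black (x≢b ∘ sym))
  second-reply : ∀ y → β₁ y ≡ free → WhiteWinsWhiteToMove (β₁ [ y ↦ black ])
  second-reply y fy with y ≟ b
  ... | yes refl =
    pairing-answers pairing-b x bx guarded (covered-b (claim-keeps-white β₁ b black {a} fb wa))
    where
    bx : (β₁ [ b ↦ black ]) x ≡ black
    bx = trans (update-other β₁ b black {x} x≢b)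
        (trans (update-other β₀ a white {x} x≢a) (update-same emptyBoard x black))
    guarded : GuardedExcept pairing-b x (β₁ [ b ↦ black ])
    guarded = guardedExcept-claim-unpaired pairing-b β₁ x b fb refl
                (guardedExcept-claim-white pairing-b β₀ x a fa (first-move-guarded pairing-b x))
  ... | no y≢b = whiteMoves b fb′ (pairing-wins no-pairs (λ ())
      (covered-hubs (claim-keeps-white β₂ b white {a} fb′ (claim-keeps-white β₁ y black {a} fy wa))
                    (update-same β₂ b white)))
    where
    β₂ = β₁ [ y ↦ black ]
    fb′ : β₂ b ≡ free
    fb′ = trans (update-other β₁ y black {b} (y≢b ∘ sym)) fb

mainTheorem11 : WhiteWinsBlackToMove emptyBoard
mainTheorem11 = blackMoves (λ done → done a refl) first-reply
  where
  first-reply : ∀ x → emptyBoard x ≡ free → WhiteWinsWhiteToMove (emptyBoard [ x ↦ black ])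
  first-reply x _ with x ≟ a | x ≟ b
  ... | yes refl | _ = other-hub-then-pairing pairing-a a b (λ ()) refl
                         (covered-a (update-same (emptyBoard [ a ↦ black ]) b white))
  ... | no _ | yes refl = other-hub-then-pairing pairing-b b a (λ ()) refl
                            (covered-b (update-same (emptyBoard [ b ↦ black ]) a white))
  ... | no x≢a | no x≢b = first-move-off-hubs x x≢a x≢b
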